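{- Let $\mathcal{P}$ be the graph with vertices $a,b,c$, edges $\{a,b\}$ and $\{b,c\}$, and a loop at $c$. For every positive integer $k$, the number of maximal configurations of the Riviera model (of any length $n\ge1$) with exactly $k$ occupied lots equals the number of closed walks of length $k+4$ in $\mathcal{P}$ that start and end at the vertex $a$ (the vertex of degree $1$). Moreover, there is an explicit bijection between these two sets.
   Context: Riviera model: a configuration of length $n$ is a word $C=(c_1,\dots,c_n)\in\{0,1\}^n$ ($c_i=1$: lot $i$ occupied; $c_i=0$: empty), with $c_j=0$ for $j\le 0$ and $j\ge n+1$. $C$ is permissible if there is no $i\in\{1,\dots,n\}$ with $c_{i-1}=c_i=c_{i+1}=1$. $C$ is maximal if it is permissible and for every $i$ with $c_i=0$, changing $c_i$ to $1$ yields a non-permissible configuration. The number of occupied lots is $\sum_i c_i$. A walk of length $\ell$ is a sequence of $\ell+1$ vertices, consecutive ones joined by an edge (the loop allows $c\to c$). -}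

module Defs where

open import Data.Nat using (ℕ; zero; suc; _+_; _≤_; _∸_)
open import Data.Bool using (Bool; true; false)
open import Data.Vec using (Vec; []; _∷_; head; last)
open import Data.Unit using (⊤)
open import Data.Product using (_×_)
open import Relation.Binary.PropositionalEquality using (_≡_)
open import Relation.Nullary using (¬_)

-- Configuration of length n: C = (c_1,…,c_n), stored as a Vec Bool n
-- (true = occupied). Entry c_i (1 ≤ i ≤ n) is the (i-1)-th vector entry.

-- c_j with the convention c_j = 0 for j ≤ 0 and j ≥ n+1 (indices j : ℕ).
cell : ∀ {n} → Vec Bool n → ℕ → Bool
cell C zero = false
cell [] (suc j) = false
cell (x ∷ C) (suc zero) = x
cell (x ∷ C) (suc (suc j)) = cell C (suc j)

Permissible : ∀ {n} → Vec Bool n → Set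
Permissible {n} C =
  ∀ i → 1 ≤ i → i ≤ n →
  ¬ (cell C (i ∸ 1) ≡ true × cell C i ≡ true × cell C (suc i) ≡ true)

occupy : ∀ {n} → Vec Bool n → ℕ → Vec Bool n
occupy [] i = []
occupy (x ∷ C) zero = x ∷ C
occupy (x ∷ C) (suc zero) = true ∷ C
occupy (x ∷ C) (suc (suc i)) = x ∷ occupy C (suc i)

Maximal : ∀ {n} → Vec Bool n → Set
Maximal {n} C =
  Permissible C ×
  (∀ i → 1 ≤ i → i ≤ n → cell C i ≡ false → ¬ Permissible (occupy C i))

occupied : ∀ {n} → Vec Bool n → ℕ
occupied [] = 0
occupied (true ∷ C) = suc (occupied C)
occupied (false ∷ C) = occupied C

-- Maximal configurations of any length n ≥ 1 with exactly k occupied lots.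
-- Proof fields are irrelevant, so equality of elements is equality of (n, C).
record MaxConfig (k : ℕ) : Set where
  constructor mkMaxConfig
  field
    len     : ℕ
    config  : Vec Bool len
    .len≥1  : 1 ≤ len
    .maximal : Maximal config
    .count≡ : occupied config ≡ k

data V : Set where
  a b c : V

data Edge : V → V → Set where
  ab : Edge a b
  ba : Edge b a
  bc : Edge b c
  cb : Edge c b
  cc : Edge c c

IsWalk : ∀ {m} → Vec V m → Set
IsWalk [] = ⊤
IsWalk (x ∷ []) = ⊤
IsWalk (x ∷ y ∷ vs) = Edge x y × IsWalk (y ∷ vs)

-- Closed walks of length ℓ (ℓ+1 vertices) starting and ending at a.
-- (P is simple apart from the loop, so a walk is determined by its vertices.)
record ClosedWalkAt-a (ℓ : ℕ) : Set where
  constructor mkWalk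
  field
    vertices : Vec V (suc ℓ)
    .walk    : IsWalk vertices
    .start   : head vertices ≡ a
    .end     : last vertices ≡ a

-- Read a word of lots through its gaps, the empty lots between consecutive occupied ones: a gap of
-- 0, 1 or 2 lots is the vertex b, c or a of 𝒫, and the unbounded empty outside is a as well.
-- Maximality is a condition on windows of five consecutive lots, and on gap sequences it says
-- exactly that consecutive gaps are adjacent in 𝒫.  Framing W as 0110 W 0110 preserves
-- maximality, so the gaps of 110 W 011, which has k + 4 occupied lots, form together with the
-- outside a closed walk a, b, …, b, a of length k + 4; and every closed walk at a of length at
-- least 5 arises in this way.
module Submission where

open import Defs
open import Data.Nat using (ℕ; zero; suc; _+_; _≤_; _<_; _∸_; z≤n; s≤s; _≟_)
open import Data.Nat.Properties
  using ( ≤-trans; n≤1+n; n<1+n; m<n⇒m<1+n; >⇒≢; <⇒≢; m≤n+m; +-monoˡ-≤; +-suc; +-assoc; +-cancelʳ-≡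
        ; suc-injective)
open import Data.Bool using (Bool; true; false; _∧_; _∨_; not; T)
import Data.Bool.Properties as Bool
open import Data.List using (List; []; _∷_; length; _++_; concatMap; [_]; drop; reverse)
open import Data.List.Properties
  using (++-assoc; length-++; reverse-++; reverse-involutive; length-reverse; ∷-injective; ≡-dec)
open import Data.Vec using (Vec; []; _∷_; toList; fromList; cast; head; last)
open import Data.Vec.Properties
  using (length-toList; toList-cast; toList∘fromList; toList-injective; cast-is-id)
open import Data.Unit using (⊤; tt)
open import Data.Empty using (⊥-elim)
open import Data.Product using (Σ; _×_; _,_; proj₁; proj₂; ∃-syntax)
open import Data.Sum using (_⊎_; inj₁; inj₂)
import Data.Sum as Sum
open import Function using (_∘_; _∘′_; id)
open import Function.Bundles using (_↔_; _⇔_; mk⇔; mk↔ₛ′; Equivalence)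
open import Relation.Binary.Definitions using (DecidableEquality)
open import Relation.Binary.PropositionalEquality
  using (_≡_; _≢_; refl; sym; trans; cong; subst; subst₂; module ≡-Reasoning)
open import Relation.Nullary using (¬_; yes; no)
open import Relation.Nullary.Decidable using (T?; recompute)

private variable
  A : Set

-- Maximality as a local condition

-- u v and x y are the two lots before and the two lots after the lot in question.
flanked : Bool → Bool → Bool → Bool → Bool
flanked u v x y = (u ∧ v) ∨ (v ∧ x) ∨ (x ∧ y)

saturated : Bool → Bool → Bool → Bool → Bool → Bool
saturated u v w x y = not (v ∧ w ∧ x) ∧ (w ∨ flanked u v x y)

flankedAt : ∀ {n} → Vec Bool n → ℕ → Bool
flankedAt C i = flanked (cell C (i ∸ 2)) (cell C (i ∸ 1)) (cell C (suc i)) (cell C (2 + i))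

saturatedAt : ∀ {n} → Vec Bool n → ℕ → Bool
saturatedAt C i = saturated (cell C (i ∸ 2)) (cell C (i ∸ 1)) (cell C i) (cell C (suc i)) (cell C (2 + i))

T-flanked : ∀ {u v x y} → T (flanked u v x y) →
            (u ≡ true × v ≡ true) ⊎ (v ≡ true × x ≡ true) ⊎ (x ≡ true × y ≡ true)
T-flanked {u} {v} {x} t =
  Sum.map both (Sum.map both both ∘′ Equivalence.to (Bool.T-∨ {v ∧ x}))
    (Equivalence.to (Bool.T-∨ {u ∧ v}) t)
  where
  both : ∀ {p q} → T (p ∧ q) → p ≡ true × q ≡ true
  both {true} {true} _ = refl , refl

flanked-left : ∀ x y → T (flanked true true x y)
flanked-left _ _ = tt

flanked-mid : ∀ u y → T (flanked u true true y)
flanked-mid true _ = tt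
flanked-mid false _ = tt

flanked-right : ∀ u v → T (flanked u v true true)
flanked-right true true = tt
flanked-right true false = tt
flanked-right false true = tt
flanked-right false false = tt

module _ {n} (C : Vec Bool n) (i : ℕ) where

  flankedAt-left : cell C (i ∸ 2) ≡ true → cell C (i ∸ 1) ≡ true → T (flankedAt C i)
  flankedAt-left p q = subst₂ (λ u v → T (flanked u v (cell C (suc i)) (cell C (2 + i))))
    (sym p) (sym q) (flanked-left (cell C (suc i)) (cell C (2 + i)))

  flankedAt-mid : cell C (i ∸ 1) ≡ true → cell C (suc i) ≡ true → T (flankedAt C i)
  flankedAt-mid p q = subst₂ (λ v x → T (flanked (cell C (i ∸ 2)) v x (cell C (2 + i))))
    (sym p) (sym q) (flanked-mid (cell C (i ∸ 2)) (cell C (2 + i)))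

  flankedAt-right : cell C (suc i) ≡ true → cell C (2 + i) ≡ true → T (flankedAt C i)
  flankedAt-right p q = subst₂ (λ x y → T (flanked (cell C (i ∸ 2)) (cell C (i ∸ 1)) x y))
    (sym p) (sym q) (flanked-right (cell C (i ∸ 2)) (cell C (i ∸ 1)))

cell-≤ : ∀ {n} (C : Vec Bool n) t → cell C t ≡ true → t ≤ n
cell-≤ (x ∷ C) (suc zero) _ = s≤s z≤n
cell-≤ (x ∷ C) (suc (suc t)) eq = s≤s (cell-≤ C (suc t) eq)

cell-occupy-≢ : ∀ {n} (C : Vec Bool n) {i t} → i ≢ t → cell (occupy C i) t ≡ cell C t
cell-occupy-≢ [] i≢t = refl
cell-occupy-≢ (x ∷ C) {zero} i≢t = refl
cell-occupy-≢ (x ∷ C) {suc zero} {zero} i≢t = refl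
cell-occupy-≢ (x ∷ C) {suc zero} {suc zero} i≢t = ⊥-elim (i≢t refl)
cell-occupy-≢ (x ∷ C) {suc zero} {suc (suc t)} i≢t = refl
cell-occupy-≢ (x ∷ C) {suc (suc i)} {zero} i≢t = refl
cell-occupy-≢ (x ∷ C) {suc (suc i)} {suc zero} i≢t = refl
cell-occupy-≢ (x ∷ C) {suc (suc i)} {suc (suc t)} i≢t = cell-occupy-≢ C (i≢t ∘ cong suc)

cell-occupy-≡ : ∀ {n} (C : Vec Bool n) i → 1 ≤ i → i ≤ n → cell (occupy C i) i ≡ true
cell-occupy-≡ (x ∷ C) (suc zero) _ _ = refl
cell-occupy-≡ (x ∷ C) (suc (suc i)) _ (s≤s i<n) = cell-occupy-≡ C (suc i) (s≤s z≤n) i<n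

occupy-reflects : ∀ {n} (C : Vec Bool n) {i t} → i ≢ t →
                  cell (occupy C i) t ≡ true → cell C t ≡ true
occupy-reflects C i≢t = trans (sym (cell-occupy-≢ C i≢t))

flanked⇒blocked : ∀ {n} (C : Vec Bool n) i → 1 ≤ i → i ≤ n →
                  T (flankedAt C i) → ¬ Permissible (occupy C i)
flanked⇒blocked C i 1≤i i≤n f perm
  with T-flanked {cell C (i ∸ 2)} {cell C (i ∸ 1)} {cell C (suc i)} {cell C (2 + i)} f
flanked⇒blocked C (suc zero) _ _ _ _ | inj₁ (() , _)
flanked⇒blocked C (suc (suc i)) _ i≤n _ perm | inj₁ (c₀ , c₁) =
  perm (suc i) (s≤s z≤n) (≤-trans (n≤1+n _) i≤n)
    ( trans (cell-occupy-≢ C (>⇒≢ (m<n⇒m<1+n (n<1+n i)))) c₀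
    , trans (cell-occupy-≢ C (>⇒≢ (n<1+n (suc i)))) c₁
    , cell-occupy-≡ C (suc (suc i)) (s≤s z≤n) i≤n )
flanked⇒blocked C (suc i) 1≤i i≤n _ perm | inj₂ (inj₁ (c₁ , c₃)) =
  perm (suc i) 1≤i i≤n
    ( trans (cell-occupy-≢ C (>⇒≢ (n<1+n i))) c₁
    , cell-occupy-≡ C (suc i) 1≤i i≤n
    , trans (cell-occupy-≢ C (<⇒≢ (n<1+n (suc i)))) c₃ )
flanked⇒blocked C i 1≤i i≤n _ perm | inj₂ (inj₂ (c₃ , c₄)) =
  perm (suc i) (s≤s z≤n) (cell-≤ C (suc i) c₃)
    ( cell-occupy-≡ C i 1≤i i≤n
    , trans (cell-occupy-≢ C (<⇒≢ (n<1+n i))) c₃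
    , trans (cell-occupy-≢ C (<⇒≢ (m<n⇒m<1+n (n<1+n i)))) c₄ )

unflanked⇒permissible : ∀ {n} (C : Vec Bool n) i → Permissible C →
                        ¬ T (flankedAt C i) → Permissible (occupy C i)
unflanked⇒permissible C i perm ¬f (suc j) 1≤j j≤n (c₀ , c₁ , c₂)
  with i ≟ j | i ≟ suc j | i ≟ suc (suc j)
... | yes refl | _ | _ =
  ¬f (flankedAt-right C i (occupy-reflects C (<⇒≢ (n<1+n i)) c₁)
                          (occupy-reflects C (<⇒≢ (m<n⇒m<1+n (n<1+n i))) c₂))
... | no _ | yes refl | _ =
  ¬f (flankedAt-mid C i (occupy-reflects C (>⇒≢ (n<1+n j)) c₀)
                        (occupy-reflects C (<⇒≢ (n<1+n i)) c₂))
... | no _ | no _ | yes refl =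
  ¬f (flankedAt-left C i (occupy-reflects C (>⇒≢ (m<n⇒m<1+n (n<1+n j))) c₀)
                         (occupy-reflects C (>⇒≢ (n<1+n (suc j))) c₁))
... | no i≢j | no i≢1+j | no i≢2+j =
  perm (suc j) 1≤j j≤n
    (occupy-reflects C i≢j c₀ , occupy-reflects C i≢1+j c₁ , occupy-reflects C i≢2+j c₂)

¬triple⇒T : ∀ p q r → ¬ (p ≡ true × q ≡ true × r ≡ true) → T (not (p ∧ q ∧ r))
¬triple⇒T true true true ¬t = ¬t (refl , refl , refl)
¬triple⇒T true true false _ = tt
¬triple⇒T true false _ _ = tt
¬triple⇒T false _ _ _ = tt

T⇒¬triple : ∀ {p q r} → T (not (p ∧ q ∧ r)) → ¬ (p ≡ true × q ≡ true × r ≡ true)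
T⇒¬triple t (refl , refl , refl) = t

maximal⇔saturated : ∀ {n} (C : Vec Bool n) →
                    Maximal C ⇔ (∀ i → 1 ≤ i → i ≤ n → T (saturatedAt C i))
maximal⇔saturated {n} C = mk⇔ to from
  where
  to : Maximal C → ∀ i → 1 ≤ i → i ≤ n → T (saturatedAt C i)
  to (perm , blocked) i 1≤i i≤n =
    Equivalence.from Bool.T-∧ (¬triple⇒T _ _ _ (perm i 1≤i i≤n) , occupiedOrFlanked)
    where
    occupiedOrFlanked : T (cell C i ∨ flankedAt C i)
    occupiedOrFlanked with cell C i in ci | T? (flankedAt C i)
    ... | true | _ = tt
    ... | false | yes f = f
    ... | false | no ¬f = ⊥-elim (blocked i 1≤i i≤n ci (unflanked⇒permissible C i perm ¬f))
  from : (∀ i → 1 ≤ i → i ≤ n → T (saturatedAt C i)) → Maximal C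
  from sat = (λ i 1≤i i≤n → T⇒¬triple (proj₁ (Equivalence.to Bool.T-∧ (sat i 1≤i i≤n))))
           , λ i 1≤i i≤n ci → flanked⇒blocked C i 1≤i i≤n
               (subst (λ w → T (w ∨ flankedAt C i)) ci
                 (proj₂ (Equivalence.to Bool.T-∧ (sat i 1≤i i≤n))))

bitAt : List Bool → ℕ → Bool
bitAt [] _ = false
bitAt (x ∷ _) zero = x
bitAt (_ ∷ L) (suc j) = bitAt L j

-- u v are the two lots before L, and all lots after L are empty.
LocallyMaximal : Bool → Bool → List Bool → Set
LocallyMaximal u v [] = ⊤
LocallyMaximal u v (w ∷ L) = T (saturated u v w (bitAt L 0) (bitAt L 1)) × LocallyMaximal v w L

MaximalWord : List Bool → Set
MaximalWord = LocallyMaximal false false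

window : List Bool → ℕ → Bool
window P j = saturated (bitAt P j) (bitAt P (1 + j)) (bitAt P (2 + j)) (bitAt P (3 + j)) (bitAt P (4 + j))

locallyMaximal⇔windows : ∀ u v L →
  LocallyMaximal u v L ⇔ (∀ j → j < length L → T (window (u ∷ v ∷ L) j))
locallyMaximal⇔windows u v [] = mk⇔ (λ _ _ ()) _
locallyMaximal⇔windows u v (w ∷ L) = mk⇔
  (λ { (s , _) zero _ → s ; (_ , lm) (suc j) (s≤s j<n) → Equivalence.to rest lm j j<n })
  (λ ws → ws zero (s≤s z≤n) , Equivalence.from rest (λ j j<n → ws (suc j) (s≤s j<n)))
  where rest = locallyMaximal⇔windows v w L

bitAt-cell : ∀ {n} (C : Vec Bool n) t → bitAt (false ∷ toList C) t ≡ cell C t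
bitAt-cell C zero = refl
bitAt-cell [] (suc t) = refl
bitAt-cell (x ∷ C) (suc zero) = refl
bitAt-cell (x ∷ C) (suc (suc t)) = bitAt-cell C (suc t)

bitAt-padded : ∀ {n} (C : Vec Bool n) t → bitAt (false ∷ false ∷ toList C) t ≡ cell C (t ∸ 1)
bitAt-padded C zero = refl
bitAt-padded C (suc t) = bitAt-cell C t

window-saturatedAt : ∀ {n} (C : Vec Bool n) j →
                     window (false ∷ false ∷ toList C) j ≡ saturatedAt C (suc j)
window-saturatedAt C j rewrite bitAt-padded C j | bitAt-padded C (1 + j) | bitAt-padded C (2 + j)
                             | bitAt-padded C (3 + j) | bitAt-padded C (4 + j) = refl

maximal⇔maximalWord : ∀ {n} (C : Vec Bool n) → Maximal C ⇔ MaximalWord (toList C)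
maximal⇔maximalWord C = mk⇔
  (λ m → Equivalence.from windows λ j j<n → subst T (sym (window-saturatedAt C j))
     (Equivalence.to (maximal⇔saturated C) m (suc j) (s≤s z≤n) (subst (j <_) (length-toList C) j<n)))
  (λ lm → Equivalence.from (maximal⇔saturated C) λ where
     (suc j) _ j<n → subst T (window-saturatedAt C j)
       (Equivalence.to windows lm j (subst (j <_) (sym (length-toList C)) j<n)))
  where windows = locallyMaximal⇔windows false false (toList C)

-- Gaps as vertices

-- A gap followed by the occupied lot closing it.
block : V → List Bool
block a = false ∷ false ∷ true ∷ []
block b = true ∷ []
block c = false ∷ true ∷ []

Chain : V → List V → V → Set
Chain x [] y = Edge x y
Chain x (v ∷ vs) y = Edge x v × Chain v vs y

decode : List Bool → List V
decode (true ∷ r) = b ∷ decode r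
decode (false ∷ true ∷ r) = c ∷ decode r
decode (false ∷ false ∷ true ∷ r) = a ∷ decode r
decode _ = []

decode-blocks : ∀ vs → decode (concatMap block vs ++ [ false ]) ≡ vs
decode-blocks [] = refl
decode-blocks (a ∷ vs) = cong (a ∷_) (decode-blocks vs)
decode-blocks (b ∷ vs) = cong (b ∷_) (decode-blocks vs)
decode-blocks (c ∷ vs) = cong (c ∷_) (decode-blocks vs)

blocks-decode : ∀ {p} U → LocallyMaximal p true (U ++ [ false ]) →
                concatMap block (decode (U ++ [ false ])) ≡ U
blocks-decode [] _ = refl
blocks-decode (true ∷ U) (_ , lm) = cong (true ∷_) (blocks-decode U lm)
blocks-decode (false ∷ true ∷ U) (_ , _ , lm) = cong (λ r → false ∷ true ∷ r) (blocks-decode U lm)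
blocks-decode (false ∷ false ∷ true ∷ U) (_ , _ , _ , lm) =
  cong (λ r → false ∷ false ∷ true ∷ r) (blocks-decode U lm)
blocks-decode (false ∷ []) (_ , () , _)
blocks-decode (false ∷ false ∷ []) (_ , () , _)
blocks-decode (false ∷ false ∷ false ∷ U) (_ , () , _)

-- A block always follows an occupied lot; the last two lots of the block of u are penultimate u, true.
penultimate : V → Bool
penultimate b = true
penultimate _ = false

-- The windows of the blocks of x, vs check every edge of x, vs, a, and the edge from u only
-- when it enters a.
maximal⇒chain : ∀ u x vs →
                LocallyMaximal (penultimate u) true (concatMap block (x ∷ vs) ++ [ false ]) →
                (x ≡ a → Edge u a) × Chain x vs a
maximal⇒chain u b [] _ = (λ ()) , ba
maximal⇒chain u b (a ∷ vs) (_ , lm) = (λ ()) , ba , proj₂ (maximal⇒chain b a vs lm)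
maximal⇒chain u b (b ∷ vs) (() , _)
maximal⇒chain u b (c ∷ vs) (_ , lm) = (λ ()) , bc , proj₂ (maximal⇒chain b c vs lm)
maximal⇒chain u c [] (_ , _ , () , _)
maximal⇒chain u c (a ∷ vs) (_ , _ , lm) with proj₁ (maximal⇒chain c a vs lm) refl
... | ()
maximal⇒chain u c (b ∷ vs) (_ , _ , lm) = (λ ()) , cb , proj₂ (maximal⇒chain c b vs lm)
maximal⇒chain u c (c ∷ vs) (_ , _ , lm) = (λ ()) , cc , proj₂ (maximal⇒chain c c vs lm)
maximal⇒chain a a _ (() , _)
maximal⇒chain c a _ (() , _)
maximal⇒chain b a [] (_ , () , _)
maximal⇒chain b a (a ∷ vs) (_ , () , _)
maximal⇒chain b a (b ∷ vs) (_ , _ , _ , lm) = (λ _ → ba) , ab , proj₂ (maximal⇒chain a b vs lm)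
maximal⇒chain b a (c ∷ vs) (_ , () , _)

chain⇒maximal : ∀ u x vs → (x ≡ a → Edge u a) → Chain x vs a →
                LocallyMaximal (penultimate u) true (concatMap block (x ∷ vs) ++ [ false ])
chain⇒maximal u b [] _ _ = _
chain⇒maximal u b (a ∷ vs) _ (ba , ch) = _ , chain⇒maximal b a vs (λ _ → ba) ch
chain⇒maximal u b (c ∷ vs) _ (bc , ch) = _ , chain⇒maximal b c vs (λ _ → ba) ch
chain⇒maximal u c (b ∷ vs) _ (cb , ch) =
  flanked-mid (penultimate u) true , _ , chain⇒maximal c b vs (λ ()) ch
chain⇒maximal u c (c ∷ vs) _ (cc , ch) =
  flanked-mid (penultimate u) false , _ , chain⇒maximal c c vs (λ ()) ch
chain⇒maximal u a (b ∷ vs) entry (ab , ch) with entry refl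
... | ba = _ , _ , _ , chain⇒maximal a b vs (λ ()) ch

-- The word of the closed walk a, vs, a, its outer a's shortened to the lots 01 and 0 next to vs.
surround : List Bool → List Bool
surround U = false ∷ true ∷ (U ++ [ false ])

closedWalk⇔maximal : ∀ vs → MaximalWord (surround (concatMap block vs)) ⇔ Chain a vs a
closedWalk⇔maximal vs = mk⇔ (to vs) (from vs)
  where
  to : ∀ vs → MaximalWord (surround (concatMap block vs)) → Chain a vs a
  to [] (() , _)
  to (a ∷ vs) (() , _)
  to (b ∷ vs) (_ , _ , lm) = ab , proj₂ (maximal⇒chain a b vs lm)
  to (c ∷ vs) (() , _)
  from : ∀ vs → Chain a vs a → MaximalWord (surround (concatMap block vs))
  from (b ∷ vs) (ab , ch) = _ , _ , chain⇒maximal a b vs (λ ()) ch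

-- Framing

frameˡ frameʳ : List Bool
frameˡ = true ∷ false ∷ []
frameʳ = false ∷ true ∷ true ∷ []

framed : List Bool → List Bool
framed W = frameˡ ++ W ++ frameʳ

frameʳ-maximal : ∀ u v → LocallyMaximal u v (frameʳ ++ [ false ])
frameʳ-maximal true true = _
frameʳ-maximal true false = _
frameʳ-maximal false true = _
frameʳ-maximal false false = _

appendFrameʳ⇔ : ∀ u v W → LocallyMaximal u v ((W ++ frameʳ) ++ [ false ]) ⇔ LocallyMaximal u v W
appendFrameʳ⇔ u v W = mk⇔ (to u v W) (from u v W)
  where
  to : ∀ u v W → LocallyMaximal u v ((W ++ frameʳ) ++ [ false ]) → LocallyMaximal u v W
  to u v [] _ = _
  to u v (w ∷ []) (s , _) = s , _
  to u v (w₁ ∷ w₂ ∷ []) (s₁ , s₂ , _) = s₁ , s₂ , _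
  to u v (w₁ ∷ w₂ ∷ w₃ ∷ W) (s , lm) = s , to v w₁ (w₂ ∷ w₃ ∷ W) lm
  from : ∀ u v W → LocallyMaximal u v W → LocallyMaximal u v ((W ++ frameʳ) ++ [ false ])
  from u v [] _ = frameʳ-maximal u v
  from u v (w ∷ []) (s , _) = s , frameʳ-maximal v w
  from u v (w₁ ∷ w₂ ∷ []) (s₁ , s₂ , _) = s₁ , s₂ , frameʳ-maximal w₁ w₂
  from u v (w₁ ∷ w₂ ∷ w₃ ∷ W) (s , lm) = s , from v w₁ (w₂ ∷ w₃ ∷ W) lm

afterVacant : ∀ u L → LocallyMaximal u false L ≡ MaximalWord L
afterVacant false L = refl
afterVacant true [] = refl
afterVacant true (w ∷ L) = refl

framed⇔maximal : ∀ W → MaximalWord (surround (framed W)) ⇔ MaximalWord W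
framed⇔maximal W = mk⇔
  (λ (_ , _ , _ , _ , lm) → subst id (afterVacant true W) (Equivalence.to frameEnd lm))
  (λ lm → _ , _ , _ , _ , Equivalence.from frameEnd (subst id (sym (afterVacant true W)) lm))
  where frameEnd = appendFrameʳ⇔ true false W

endsWith-frameʳ : ∀ x vs → Chain x vs a → 2 ≤ length vs →
              ∃[ U ] concatMap block vs ≡ U ++ frameʳ
endsWith-frameʳ x (_ ∷ []) _ (s≤s ())
endsWith-frameʳ x (a ∷ b ∷ []) (_ , ab , ba) _ = false ∷ [] , refl
endsWith-frameʳ x (b ∷ b ∷ []) (_ , () , _) _
endsWith-frameʳ x (c ∷ b ∷ []) (_ , cb , ba) _ = [] , refl
endsWith-frameʳ x (v ∷ w ∷ u ∷ vs) (_ , ch) _ =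
  let U , eq = endsWith-frameʳ v (w ∷ u ∷ vs) ch (s≤s (s≤s z≤n))
  in block v ++ U , trans (cong (block v ++_) eq) (sym (++-assoc (block v) U _))

closedWalk-framed : ∀ vs → Chain a vs a → 4 ≤ length vs → ∃[ W ] concatMap block vs ≡ framed W
closedWalk-framed (b ∷ a ∷ vs) (ab , ba , ch) (s≤s (s≤s 2≤n)) =
  let U , eq = endsWith-frameʳ a vs ch 2≤n
  in false ∷ true ∷ U , cong (λ r → true ∷ false ∷ false ∷ true ∷ r) eq
closedWalk-framed (b ∷ c ∷ vs) (ab , bc , ch) (s≤s (s≤s 2≤n)) =
  let U , eq = endsWith-frameʳ c vs ch 2≤n
  in true ∷ U , cong (λ r → true ∷ false ∷ true ∷ r) eq

drop-++ : ∀ (P M : List A) → drop (length P) (P ++ M) ≡ M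
drop-++ [] M = refl
drop-++ (_ ∷ P) M = drop-++ P M

strip : ℕ → ℕ → List A → List A
strip m n = reverse ∘ drop n ∘ reverse ∘ drop m

strip-++ : ∀ (P M Q : List A) → strip (length P) (length Q) (P ++ M ++ Q) ≡ M
strip-++ P M Q = begin
  reverse (drop (length Q) (reverse (drop (length P) (P ++ M ++ Q))))
    ≡⟨ cong (reverse ∘ drop (length Q) ∘ reverse) (drop-++ P (M ++ Q)) ⟩
  reverse (drop (length Q) (reverse (M ++ Q)))
    ≡⟨ cong (reverse ∘ drop (length Q)) (reverse-++ M Q) ⟩
  reverse (drop (length Q) (reverse Q ++ reverse M))
    ≡⟨ cong (λ n → reverse (drop n (reverse Q ++ reverse M))) (length-reverse Q) ⟨
  reverse (drop (length (reverse Q)) (reverse Q ++ reverse M))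
    ≡⟨ cong reverse (drop-++ (reverse Q) (reverse M)) ⟩
  reverse (reverse M)
    ≡⟨ reverse-involutive M ⟩
  M ∎
  where open ≡-Reasoning

ones : List Bool → ℕ
ones [] = 0
ones (true ∷ L) = suc (ones L)
ones (false ∷ L) = ones L

ones-++ : ∀ L M → ones (L ++ M) ≡ ones L + ones M
ones-++ [] M = refl
ones-++ (true ∷ L) M = cong suc (ones-++ L M)
ones-++ (false ∷ L) M = ones-++ L M

ones≤length : ∀ L → ones L ≤ length L
ones≤length [] = z≤n
ones≤length (true ∷ L) = s≤s (ones≤length L)
ones≤length (false ∷ L) = ≤-trans (ones≤length L) (n≤1+n _)

occupied≡ones : ∀ {n} (C : Vec Bool n) → occupied C ≡ ones (toList C)
occupied≡ones [] = refl
occupied≡ones (true ∷ C) = cong suc (occupied≡ones C)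
occupied≡ones (false ∷ C) = occupied≡ones C

ones-blocks : ∀ vs → ones (concatMap block vs) ≡ length vs
ones-blocks [] = refl
ones-blocks (a ∷ vs) = cong suc (ones-blocks vs)
ones-blocks (b ∷ vs) = cong suc (ones-blocks vs)
ones-blocks (c ∷ vs) = cong suc (ones-blocks vs)

ones-framed : ∀ W → ones (framed W) ≡ ones W + 3
ones-framed W = trans (cong suc (ones-++ W _)) (sym (+-suc (ones W) 2))

Σ-fromList∘toList : ∀ {n} (C : Vec A n) →
                    _≡_ {A = Σ ℕ (Vec A)} (length (toList C) , fromList (toList C)) (n , C)
Σ-fromList∘toList [] = refl
Σ-fromList∘toList (x ∷ C) = cong (λ (m , D) → suc m , x ∷ D) (Σ-fromList∘toList C)

_≟ᵛ_ : DecidableEquality V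
a ≟ᵛ a = yes refl
a ≟ᵛ b = no λ ()
a ≟ᵛ c = no λ ()
b ≟ᵛ a = no λ ()
b ≟ᵛ b = yes refl
b ≟ᵛ c = no λ ()
c ≟ᵛ a = no λ ()
c ≟ᵛ b = no λ ()
c ≟ᵛ c = yes refl

isWalk⇒chain : ∀ {m} x (ts : Vec V m) → 1 ≤ m → IsWalk (x ∷ ts) →
             ∃[ vs ] toList ts ≡ vs ++ [ last (x ∷ ts) ] × Chain x vs (last (x ∷ ts))
isWalk⇒chain x (t ∷ []) _ (e , _) = [] , refl , e
isWalk⇒chain x (t ∷ t′ ∷ ts) _ (e , w) =
  let vs , eq , ch = isWalk⇒chain t (t′ ∷ ts) (s≤s z≤n) w in t ∷ vs , cong (t ∷_) eq , e , ch

chain⇒isWalk : ∀ {m} x (ts : Vec V m) vs y → toList ts ≡ vs ++ [ y ] → Chain x vs y →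
             IsWalk (x ∷ ts) × last (x ∷ ts) ≡ y
chain⇒isWalk x (t ∷ []) [] y refl e = (e , _) , refl
chain⇒isWalk x (t ∷ t′ ∷ ts) (v ∷ vs) y eq (e , ch) with ∷-injective eq
... | refl , eq′ = let w , l = chain⇒isWalk t (t′ ∷ ts) vs y eq′ ch in (e , w) , l
chain⇒isWalk x (t ∷ []) (v ∷ []) y () _
chain⇒isWalk x (t ∷ []) (v ∷ _ ∷ _) y () _
chain⇒isWalk x (t ∷ _ ∷ _) [] y () _
chain⇒isWalk x [] [] y () _
chain⇒isWalk x [] (_ ∷ _) y () _

-- The bijection

walkOf : List Bool → List V
walkOf W = decode (framed W ++ [ false ])

configOf : List V → List Bool
configOf vs = strip 2 3 (concatMap block vs)

module _ {W : List Bool} (max : MaximalWord W) where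

  blocks-walkOf : concatMap block (walkOf W) ≡ framed W
  blocks-walkOf =
    blocks-decode {false} (framed W) (proj₂ (proj₂ (Equivalence.from (framed⇔maximal W) max)))

  walkOf-closed : Chain a (walkOf W) a
  walkOf-closed = Equivalence.to (closedWalk⇔maximal (walkOf W))
    (subst (MaximalWord ∘ surround) (sym blocks-walkOf) (Equivalence.from (framed⇔maximal W) max))

  configOf-walkOf : configOf (walkOf W) ≡ W
  configOf-walkOf =
    trans (cong (strip 2 3) blocks-walkOf) (strip-++ frameˡ W frameʳ)

  length-walkOf : length (walkOf W) ≡ ones W + 3
  length-walkOf = trans (sym (ones-blocks (walkOf W))) (trans (cong ones blocks-walkOf) (ones-framed W))

module _ {vs : List V} (ch : Chain a vs a) (long : 4 ≤ length vs) where

  blocks-configOf : concatMap block vs ≡ framed (configOf vs)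
  blocks-configOf = let W , eq = closedWalk-framed vs ch long in
    trans eq (cong framed (sym (trans (cong (strip 2 3) eq) (strip-++ frameˡ W frameʳ))))

  configOf-maximal : MaximalWord (configOf vs)
  configOf-maximal = Equivalence.to (framed⇔maximal _)
    (subst (MaximalWord ∘ surround) blocks-configOf (Equivalence.from (closedWalk⇔maximal vs) ch))

  walkOf-configOf : walkOf (configOf vs) ≡ vs
  walkOf-configOf = trans (cong (λ U → decode (U ++ [ false ])) (sym blocks-configOf)) (decode-blocks vs)

  length-configOf : length vs ≡ ones (configOf vs) + 3
  length-configOf =
    trans (sym (ones-blocks vs)) (trans (cong ones blocks-configOf) (ones-framed (configOf vs)))

interior : ∀ {m} → Vec V m → List V
interior v = strip 1 1 (toList v)

closedWalk-interior : ∀ k (v : Vec V (suc (k + 4))) → IsWalk v → head v ≡ a → last v ≡ a →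
  toList v ≡ a ∷ interior v ++ [ a ] × Chain a (interior v) a × length (interior v) ≡ k + 3
closedWalk-interior k (.a ∷ ts) walk refl end
  with isWalk⇒chain a ts (≤-trans (s≤s z≤n) (m≤n+m 4 k)) walk
... | vs , eq , ch = subst Shape (sym interior≡vs) (toList≡ , subst (Chain a vs) end ch , length-vs)
  where
  Shape : List V → Set
  Shape us = toList (a ∷ ts) ≡ a ∷ us ++ [ a ] × Chain a us a × length us ≡ k + 3
  toList≡ : toList (a ∷ ts) ≡ a ∷ vs ++ [ a ]
  toList≡ = cong (a ∷_) (trans eq (cong (λ y → vs ++ [ y ]) end))
  interior≡vs : interior (a ∷ ts) ≡ vs
  interior≡vs = trans (cong (strip 1 1) toList≡) (strip-++ [ a ] vs [ a ])
  length-vs : length vs ≡ k + 3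
  length-vs = +-cancelʳ-≡ 1 (length vs) (k + 3) (begin
    length vs + 1         ≡⟨ length-++ vs ⟨
    length (vs ++ [ a ])  ≡⟨ suc-injective (cong length toList≡) ⟨
    length (toList ts)    ≡⟨ length-toList ts ⟩
    k + 4                 ≡⟨ +-assoc k 3 1 ⟨
    k + 3 + 1             ∎)
    where open ≡-Reasoning

module _ {k} (1≤k : 1 ≤ k) {v : Vec V (suc (k + 4))}
         (walk : IsWalk v) (start : head v ≡ a) (end : last v ≡ a) where

  private
    shape = closedWalk-interior k v walk start end

  vertices-interior : toList v ≡ a ∷ interior v ++ [ a ]
  vertices-interior = proj₁ shape

  interior-closed : Chain a (interior v) a
  interior-closed = proj₁ (proj₂ shape)

  interior-long : 4 ≤ length (interior v)
  interior-long = subst (4 ≤_) (sym (proj₂ (proj₂ shape))) (+-monoˡ-≤ 3 1≤k)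

  ones-configOf-interior : ones (configOf (interior v)) ≡ k
  ones-configOf-interior = +-cancelʳ-≡ 3 _ k
    (trans (sym (length-configOf interior-closed interior-long)) (proj₂ (proj₂ shape)))

toList-closing : ∀ {n} (vs : List V) .(e : length (vs ++ [ a ]) ≡ n) →
                 toList (cast e (fromList (vs ++ [ a ]))) ≡ vs ++ [ a ]
toList-closing vs e = trans (toList-cast e _) (toList∘fromList (vs ++ [ a ]))

interior-closing : ∀ {n} (vs : List V) .(e : length (vs ++ [ a ]) ≡ n) →
                   interior (a ∷ cast e (fromList (vs ++ [ a ]))) ≡ vs
interior-closing vs e = trans (cong (strip 1 1 ∘ (a ∷_)) (toList-closing vs e)) (strip-++ [ a ] vs [ a ])

toWalk : ∀ k → MaxConfig k → ClosedWalkAt-a (k + 4)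
toWalk k (mkMaxConfig n C _ max count) =
  mkWalk (a ∷ cast (length-closing max count) (fromList (vs ++ [ a ])))
         (proj₁ (closing-walk max count)) refl (proj₂ (closing-walk max count))
  where
  vs = walkOf (toList C)
  maxWord : Maximal C → MaximalWord (toList C)
  maxWord = Equivalence.to (maximal⇔maximalWord C)
  length-closing : Maximal C → occupied C ≡ k → length (vs ++ [ a ]) ≡ k + 4
  length-closing max count = begin
    length (vs ++ [ a ])    ≡⟨ length-++ vs ⟩
    length vs + 1           ≡⟨ cong (_+ 1) (length-walkOf (maxWord max)) ⟩
    ones (toList C) + 3 + 1 ≡⟨ cong (λ m → m + 3 + 1) (trans (sym (occupied≡ones C)) count) ⟩
    k + 3 + 1               ≡⟨ +-assoc k 3 1 ⟩
    k + 4                   ∎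
    where open ≡-Reasoning
  closing-walk : (max : Maximal C) (count : occupied C ≡ k) →
    let v = a ∷ cast (length-closing max count) (fromList (vs ++ [ a ])) in IsWalk v × last v ≡ a
  closing-walk max count =
    chain⇒isWalk a _ vs a (toList-closing vs (length-closing max count)) (walkOf-closed (maxWord max))

fromWalk : ∀ k → 1 ≤ k → ClosedWalkAt-a (k + 4) → MaxConfig k
fromWalk k 1≤k (mkWalk v walk start end) =
  mkMaxConfig (length W) (fromList W)
    (nonempty walk start end) (maximal walk start end) (count walk start end)
  where
  W = configOf (interior v)
  module _ (walk : IsWalk v) (start : head v ≡ a) (end : last v ≡ a) where
    maximal : Maximal (fromList W)
    maximal = Equivalence.from (maximal⇔maximalWord (fromList W))
      (subst MaximalWord (sym (toList∘fromList W))
        (configOf-maximal (interior-closed 1≤k walk start end) (interior-long 1≤k walk start end)))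
    count : occupied (fromList W) ≡ k
    count = trans (occupied≡ones (fromList W))
      (trans (cong ones (toList∘fromList W)) (ones-configOf-interior 1≤k walk start end))
    nonempty : 1 ≤ length W
    nonempty =
      ≤-trans (subst (1 ≤_) (sym (ones-configOf-interior 1≤k walk start end)) 1≤k) (ones≤length W)

mkMaxConfig-≡ : ∀ {k n m} {C : Vec Bool n} {D : Vec Bool m} .{l l′ mx mx′ c c′} →
                _≡_ {A = Σ ℕ (Vec Bool)} (n , C) (m , D) →
                mkMaxConfig {k} n C l mx c ≡ mkMaxConfig m D l′ mx′ c′
mkMaxConfig-≡ refl = refl

mkWalk-≡ : ∀ {ℓ} {v v′ : Vec V (suc ℓ)} .{w w′ s s′ e e′} → v ≡ v′ →
           mkWalk v w s e ≡ mkWalk v′ w′ s′ e′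
mkWalk-≡ refl = refl

fromWalk∘toWalk : ∀ k (1≤k : 1 ≤ k) x → fromWalk k 1≤k (toWalk k x) ≡ x
fromWalk∘toWalk k 1≤k x@(mkMaxConfig n C _ max _) =
  mkMaxConfig-≡ (trans (cong (λ W → length W , fromList W) W≡C) (Σ-fromList∘toList C))
  where
  W≡C : configOf (interior (ClosedWalkAt-a.vertices (toWalk k x))) ≡ toList C
  W≡C = recompute (≡-dec Bool._≟_ _ _) (trans
    (cong configOf (interior-closing {k + 4} (walkOf (toList C)) _))
    (configOf-walkOf (Equivalence.to (maximal⇔maximalWord C) max)))

toWalk∘fromWalk : ∀ k (1≤k : 1 ≤ k) y → toWalk k (fromWalk k 1≤k y) ≡ y
toWalk∘fromWalk k 1≤k y@(mkWalk v walk start end) =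
  mkWalk-≡ (trans (sym (cast-is-id refl _)) (toList-injective refl _ v toList≡))
  where
  W = configOf (interior v)
  toList≡ : toList (ClosedWalkAt-a.vertices (toWalk k (fromWalk k 1≤k y))) ≡ toList v
  toList≡ = recompute (≡-dec _≟ᵛ_ _ _) (begin
    a ∷ toList (cast _ (fromList (walkOf (toList (fromList W)) ++ [ a ])))
      ≡⟨ cong (a ∷_) (toList-closing (walkOf (toList (fromList W))) _) ⟩
    a ∷ walkOf (toList (fromList W)) ++ [ a ]
      ≡⟨ cong (λ W → a ∷ walkOf W ++ [ a ]) (toList∘fromList W) ⟩
    a ∷ walkOf W ++ [ a ]
      ≡⟨ cong (λ us → a ∷ us ++ [ a ]) (walkOf-configOf (interior-closed 1≤k walk start end)
                                                        (interior-long 1≤k walk start end)) ⟩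
    a ∷ interior v ++ [ a ]
      ≡⟨ vertices-interior 1≤k walk start end ⟨
    toList v ∎)
    where open ≡-Reasoning

theorem2p4 : (k : ℕ) → 1 ≤ k → MaxConfig k ↔ ClosedWalkAt-a (k + 4)
theorem2p4 k 1≤k =
  mk↔ₛ′ (toWalk k) (fromWalk k 1≤k) (toWalk∘fromWalk k 1≤k) (fromWalk∘toWalk k 1≤k)
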